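{- The matroid $S_{10}$ is representable over the partial fields $\mathbb{U}_2$ and $\mathbb{P}_4$.
   Context: Over $\mathrm{GF}(4)$ let $\alpha^2=\alpha+1$. The Betsy Ross matroid $B_{11}$ is the column matroid over $\mathrm{GF}(4)$ of the matrix with columns labelled $1,\dots,11$: $[1,0,0,1,1,0,\alpha,\alpha,\alpha^2,1,0;\ 0,1,0,1,0,1,\alpha,1,\alpha^2,\alpha,\alpha;\ 0,0,1,0,1,1,1,0,1,1,1]$ (rows separated by semicolons). Its hub is element $5$, the unique element lying on five three-point lines. $S_{10}=B_{11}\backslash 5$. A partial field is a pair $(R,G)$, $R$ a commutative ring with identity, $G$ a subgroup of its units containing $-1$; a matrix over it is a $\mathbb{P}$-matrix if every square subdeterminant lies in $G\cup\{0\}$, and a rank-$r$ matroid is $\mathbb{P}$-representable if it is the column matroid of an $r$-rowed $\mathbb{P}$-matrix. $\mathbb{U}_2=(\mathbb{Q}(\alpha_1,\alpha_2),\langle-1,\alpha_1,\alpha_2,\alpha_1-1,\alpha_2-1,\alpha_1-\alpha_2\rangle)$ and $\mathbb{P}_4=(\mathbb{Q}(x),\langle-1,x,x-1,x+1,x-2\rangle)$, with $\alpha_1,\alpha_2,x$ indeterminates. -}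

module Defs where

open import Level using (0ℓ)
open import Algebra.Bundles.Raw using (RawRing)
open import Data.Unit using (⊤; tt)
open import Data.Empty using (⊥)
open import Data.Bool using (Bool; true; false)
open import Data.Nat using (ℕ; zero; suc)
open import Data.Integer as ℤ using (ℤ; +_; -[1+_])
open import Data.Fin using (Fin; zero; suc; _<_; punchIn; #_)
open import Data.List using (List; []; _∷_; map)
open import Data.Product using (_×_; _,_; Σ; ∃; proj₁; proj₂)
open import Data.Sum using (_⊎_)
open import Relation.Nullary using (¬_)
open import Relation.Binary.PropositionalEquality using (_≡_)
open import Function.Bundles using (_⇔_)

module RingOps (R : RawRing 0ℓ 0ℓ) where
  open RawRing R

  altSum : ∀ {n} → (Fin n → Carrier) → Carrier
  altSum {zero}  f = 0#
  altSum {suc n} f = f zero + - altSum (λ j → f (suc j))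

  det : ∀ {k} → (Fin k → Fin k → Carrier) → Carrier
  det {zero}  M = 1#
  det {suc k} M =
    altSum (λ j → M zero j * det (λ r c → M (suc r) (punchIn j c)))

-- Univariate polynomials over a raw ring: coefficient lists, constant
-- term first; equality is coefficientwise up to trailing zeros.

module PolyOps (R : RawRing 0ℓ 0ℓ) where
  open RawRing R

  Poly : Set
  Poly = List Carrier

  _≈ₚ_ : Poly → Poly → Set
  []       ≈ₚ []       = ⊤
  []       ≈ₚ (b ∷ bs) = (0# ≈ b) × ([] ≈ₚ bs)
  (a ∷ as) ≈ₚ []       = (a ≈ 0#) × (as ≈ₚ [])
  (a ∷ as) ≈ₚ (b ∷ bs) = (a ≈ b) × (as ≈ₚ bs)

  _+ₚ_ : Poly → Poly → Poly
  []       +ₚ q        = q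
  (a ∷ as) +ₚ []       = a ∷ as
  (a ∷ as) +ₚ (b ∷ bs) = (a + b) ∷ (as +ₚ bs)

  -ₚ_ : Poly → Poly
  -ₚ p = map -_ p

  _*ₚ_ : Poly → Poly → Poly
  []       *ₚ q = []
  (a ∷ as) *ₚ q = map (a *_) q +ₚ (0# ∷ (as *ₚ q))

  X : Poly
  X = 0# ∷ 1# ∷ []

  const : Carrier → Poly
  const a = a ∷ []

polyRing : RawRing 0ℓ 0ℓ → RawRing 0ℓ 0ℓ
polyRing R = record
  { Carrier = Poly ; _≈_ = _≈ₚ_ ; _+_ = _+ₚ_ ; _*_ = _*ₚ_ ; -_ = -ₚ_
  ; 0# = [] ; 1# = RawRing.1# R ∷ [] }
  where open PolyOps R

-- Carrier is pairs (numerator , denominator); genuine elements of the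
-- fraction field are those with nonzero denominator (predicate `Proper`).

fracRing : RawRing 0ℓ 0ℓ → RawRing 0ℓ 0ℓ
fracRing R = record
  { Carrier = Carrier × Carrier
  ; _≈_ = λ { (a , b) (c , d) → (a * d) ≈ (c * b) }
  ; _+_ = λ { (a , b) (c , d) → ((a * d) + (c * b)) , (b * d) }
  ; _*_ = λ { (a , b) (c , d) → (a * c) , (b * d) }
  ; -_  = λ { (a , b) → (- a) , b }
  ; 0#  = 0# , 1#
  ; 1#  = 1# , 1# }
  where open RawRing R

Proper : (R : RawRing 0ℓ 0ℓ) → RawRing.Carrier (fracRing R) → Set
Proper R (a , b) = ¬ (b ≈ 0#)
  where open RawRing R

toFrac : (R : RawRing 0ℓ 0ℓ) → RawRing.Carrier R → RawRing.Carrier (fracRing R)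
toFrac R a = a , RawRing.1# R

-- Partial fields.  `Elem` singles out the genuine elements of the
-- carrier (needed for the fraction construction), `G` is the group.

record PartialField : Set₁ where
  field
    ring : RawRing 0ℓ 0ℓ
    Elem : RawRing.Carrier ring → Set
    G    : RawRing.Carrier ring → Set
  open RawRing ring public

module PF (P : PartialField) where
  open PartialField P
  open RingOps ring public

  StrictlyIncreasing : ∀ {k n} → (Fin k → Fin n) → Set
  StrictlyIncreasing f = ∀ i j → i < j → f i < f j

  sub : ∀ {r n k} → (Fin r → Fin n → Carrier) →
        (Fin k → Fin r) → (Fin k → Fin n) → Fin k → Fin k → Carrier
  sub A f g i j = A (f i) (g j)

  IsPMatrix : ∀ {r n} → (Fin r → Fin n → Carrier) → Set
  IsPMatrix {r} {n} A =
    (∀ i j → Elem (A i j)) ×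
    (∀ k (f : Fin k → Fin r) (g : Fin k → Fin n) →
       StrictlyIncreasing f → StrictlyIncreasing g →
       G (det (sub A f g)) ⊎ (det (sub A f g) ≈ 0#))

  -- M (rank r on Fin n, given by its bases = r-element subsets, listed as
  -- strictly increasing maps Fin r → Fin n) is the column matroid of the
  -- r-rowed matrix A: the bases are exactly the r-sets of columns with
  -- nonzero r×r determinant.
  IsColumnMatroidOf : ∀ {r n} → (Fin r → Fin n → Carrier) →
                      ((Fin r → Fin n) → Set) → Set
  IsColumnMatroidOf {r} {n} A Basis =
    ∀ (g : Fin r → Fin n) → StrictlyIncreasing g →
      (¬ (det (λ i j → A i (g j)) ≈ 0#)) ⇔ Basis g

  Representable : (r n : ℕ) → ((Fin r → Fin n) → Set) → Set
  Representable r n Basis =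
    Σ (Fin r → Fin n → Carrier) λ A → IsPMatrix A × IsColumnMatroidOf A Basis

-- GF(4) = {0, 1, α, α²} with α² = α + 1.

data GF4 : Set where
  o i a a² : GF4

_⊕_ : GF4 → GF4 → GF4
o  ⊕ y  = y
x  ⊕ o  = x
i  ⊕ i  = o
i  ⊕ a  = a²
i  ⊕ a² = a
a  ⊕ i  = a²
a  ⊕ a  = o
a  ⊕ a² = i
a² ⊕ i  = a
a² ⊕ a  = i
a² ⊕ a² = o

_⊗_ : GF4 → GF4 → GF4
o  ⊗ y  = o
x  ⊗ o  = o
i  ⊗ y  = y
x  ⊗ i  = x
a  ⊗ a  = a²
a  ⊗ a² = i
a² ⊗ a  = i
a² ⊗ a² = a

GF4ring : RawRing 0ℓ 0ℓ
GF4ring = record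
  { Carrier = GF4 ; _≈_ = _≡_ ; _+_ = _⊕_ ; _*_ = _⊗_ ; -_ = λ x → x
  ; 0# = o ; 1# = i }

-- The GF(4)-matrix of B11 (columns 1..11 are Fin 11 indices 0..10).
B11matrix : Fin 3 → Fin 11 → GF4
B11matrix zero = λ where
  zero → i ; (suc zero) → o ; (suc (suc zero)) → o ; (suc (suc (suc zero))) → i
  (suc (suc (suc (suc zero)))) → i ; (suc (suc (suc (suc (suc zero))))) → o
  (suc (suc (suc (suc (suc (suc zero)))))) → a
  (suc (suc (suc (suc (suc (suc (suc zero))))))) → a
  (suc (suc (suc (suc (suc (suc (suc (suc zero)))))))) → a²
  (suc (suc (suc (suc (suc (suc (suc (suc (suc zero))))))))) → i
  (suc (suc (suc (suc (suc (suc (suc (suc (suc (suc zero)))))))))) → o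
B11matrix (suc zero) = λ where
  zero → o ; (suc zero) → i ; (suc (suc zero)) → o ; (suc (suc (suc zero))) → i
  (suc (suc (suc (suc zero)))) → o ; (suc (suc (suc (suc (suc zero))))) → i
  (suc (suc (suc (suc (suc (suc zero)))))) → a
  (suc (suc (suc (suc (suc (suc (suc zero))))))) → i
  (suc (suc (suc (suc (suc (suc (suc (suc zero)))))))) → a²
  (suc (suc (suc (suc (suc (suc (suc (suc (suc zero))))))))) → a
  (suc (suc (suc (suc (suc (suc (suc (suc (suc (suc zero)))))))))) → a
B11matrix (suc (suc zero)) = λ where
  zero → o ; (suc zero) → o ; (suc (suc zero)) → i ; (suc (suc (suc zero))) → o
  (suc (suc (suc (suc zero)))) → i ; (suc (suc (suc (suc (suc zero))))) → i
  (suc (suc (suc (suc (suc (suc zero)))))) → i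
  (suc (suc (suc (suc (suc (suc (suc zero))))))) → o
  (suc (suc (suc (suc (suc (suc (suc (suc zero)))))))) → i
  (suc (suc (suc (suc (suc (suc (suc (suc (suc zero))))))))) → i
  (suc (suc (suc (suc (suc (suc (suc (suc (suc (suc zero)))))))))) → i

B11Basis : (Fin 3 → Fin 11) → Set
B11Basis g = ¬ (RingOps.det GF4ring (λ r c → B11matrix r (g c)) ≡ o)

-- S10 = B11 \ 5.  Its ground set {1,2,3,4,6,...,11} is indexed by Fin 10
-- via punchIn (# 4) (skipping element 5, i.e. index 4).  Since 5 is not a
-- coloop of B11, the bases of B11 \ 5 are the bases of B11 avoiding 5.
S10label : Fin 10 → Fin 11
S10label = punchIn (# 4)

S10Basis : (Fin 3 → Fin 10) → Set
S10Basis g = B11Basis (λ c → S10label (g c))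

ℤring : RawRing 0ℓ 0ℓ
ℤring = ℤ.+-*-rawRing

ℤ[x] : RawRing 0ℓ 0ℓ
ℤ[x] = polyRing ℤring

ℤ[α₁,α₂] : RawRing 0ℓ 0ℓ
ℤ[α₁,α₂] = polyRing ℤ[x]

module Monomials (R : RawRing 0ℓ 0ℓ) where
  open RawRing R
  pow : Carrier → ℕ → Carrier
  pow x zero    = 1#
  pow x (suc n) = x * pow x n

  posPart negPart : ℤ → ℕ
  posPart (+ n)    = n
  posPart -[1+ n ] = 0
  negPart (+ n)    = 0
  negPart -[1+ n ] = suc n

  prodPow : ∀ {k} → (Fin k → Carrier) → (ℤ → ℕ) → (Fin k → ℤ) → Carrier
  prodPow {zero}  g part e = 1#
  prodPow {suc k} g part e =
    pow (g zero) (part (e zero)) * prodPow (λ j → g (suc j)) part (λ j → e (suc j))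

GeneratedBy : (R : RawRing 0ℓ 0ℓ) → ∀ {k} → (Fin k → RawRing.Carrier R) →
              RawRing.Carrier (fracRing R) → Set
GeneratedBy R {k} gens z =
  Σ Bool λ s → Σ (Fin k → ℤ) λ e →
    RawRing._≈_ (fracRing R) z
      (sign s * prodPow gens posPart e , prodPow gens negPart e)
  where
  open RawRing R
  open Monomials R
  sign : Bool → Carrier
  sign true  = 1#
  sign false = - 1#

-- 𝕌₂ = (ℚ(α1,α2), ⟨-1, α1, α2, α1-1, α2-1, α1-α2⟩); ℚ(α1,α2) is realised
-- as the fraction field of ℤ[α1,α2].
module U2gens where
  open PolyOps ℤ[x] using (X; const)
  open RawRing ℤ[α₁,α₂]
  α₁ α₂ : Carrier
  α₁ = const (0ℤ ∷ 1ℤ ∷ [])   where open RawRing ℤring renaming (0# to 0ℤ; 1# to 1ℤ)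
  α₂ = X
  gens : Fin 5 → Carrier
  gens zero                               = α₁
  gens (suc zero)                         = α₂
  gens (suc (suc zero))                   = α₁ + - 1#
  gens (suc (suc (suc zero)))             = α₂ + - 1#
  gens (suc (suc (suc (suc zero))))       = α₁ + - α₂

𝕌₂ : PartialField
𝕌₂ = record
  { ring = fracRing ℤ[α₁,α₂]
  ; Elem = Proper ℤ[α₁,α₂]
  ; G    = GeneratedBy ℤ[α₁,α₂] U2gens.gens }

-- ℙ₄ = (ℚ(x), ⟨-1, x, x-1, x+1, x-2⟩); ℚ(x) = fraction field of ℤ[x].
module P4gens where
  open PolyOps ℤring using (X)
  open RawRing ℤ[x]
  gens : Fin 4 → Carrier
  gens zero                   = X
  gens (suc zero)             = X + - 1#
  gens (suc (suc zero))       = X + 1#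
  gens (suc (suc (suc zero))) = X + - (1# + 1#)

ℙ₄ : PartialField
ℙ₄ = record
  { ring = fracRing ℤ[x]
  ; Elem = Proper ℤ[x]
  ; G    = GeneratedBy ℤ[x] P4gens.gens }

-- Both partial fields are fraction fields of polynomial rings over ℤ, with
-- equality decidable by cross-multiplication, so the conditions on a matrix
-- can be checked minor by minor.  For the matrices below every minor is zero
-- or ± a product of at most two generators, and a 3×3 minor vanishes exactly
-- when the corresponding GF(4)-minor of B₁₁ does.  The ℙ₄-matrix is the image
-- of the 𝕌₂-matrix under α₁ ↦ x, α₂ ↦ x − 1.

module Submission where

open import Defs
open import Level using (0ℓ)
open import Algebra.Bundles.Raw using (RawRing)
open import Data.Bool using (Bool; true; false)
open import Data.Empty using (⊥-elim)
open import Data.Nat as ℕ using (ℕ; zero; suc; _∸_; s≤s)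
open import Data.Nat.Properties using (_≤?_; ≮⇒≥; allUpTo?)
open import Data.Integer as ℤ using (ℤ; +_)
open import Data.Fin using (Fin; zero; suc; _<_; punchIn)
open import Data.Fin.Properties using (all?; _<?_; pigeonhole; <-irrefl)
open import Data.Vec using (Vec; lookup) renaming ([] to []ᵛ; _∷_ to _∷ᵛ_)
open import Data.Vec.Functional using () renaming ([] to []ᶠ; _∷_ to _∷ᶠ_)
open import Data.List using (List; []; _∷_; map; concatMap; upTo; foldr)
open import Data.List.Relation.Unary.Any using (Any; any?; satisfied)
open import Data.Product using (_×_; _,_)
open import Data.Sum using (_⊎_; inj₁; inj₂)
open import Function using (_∘_)
open import Function.Bundles using (_⇔_; mk⇔; Equivalence)
open import Relation.Binary using (Decidable)
open import Relation.Binary.PropositionalEquality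
  using (_≡_; _≗_; refl; sym; trans; cong; cong₂; subst; subst₂)
open import Relation.Nullary using (¬_; Dec; yes; no; ¬?)
open import Relation.Nullary.Decidable
  using (True; False; toWitness; toWitnessFalse; map′; _×-dec_; _⊎-dec_; _→-dec_)

module _ {R : RawRing 0ℓ 0ℓ} where
  open RawRing R
  open PolyOps R

  ≈ₚ-dec : Decidable _≈_ → Decidable _≈ₚ_
  ≈ₚ-dec _≟_ []       []       = yes _
  ≈ₚ-dec _≟_ []       (y ∷ ys) = (0# ≟ y) ×-dec ≈ₚ-dec _≟_ [] ys
  ≈ₚ-dec _≟_ (x ∷ xs) []       = (x ≟ 0#) ×-dec ≈ₚ-dec _≟_ xs []
  ≈ₚ-dec _≟_ (x ∷ xs) (y ∷ ys) = (x ≟ y) ×-dec ≈ₚ-dec _≟_ xs ys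

module _ {R : RawRing 0ℓ 0ℓ} where
  open RawRing R
  open RingOps R

  altSum-cong : ∀ {n} {f g : Fin n → Carrier} → f ≗ g → altSum f ≡ altSum g
  altSum-cong {zero}  f≗g = refl
  altSum-cong {suc n} f≗g =
    cong₂ (λ x y → x + - y) (f≗g zero) (altSum-cong (f≗g ∘ suc))

  det-cong : ∀ {k} {M N : Fin k → Fin k → Carrier} →
             (∀ p q → M p q ≡ N p q) → det M ≡ det N
  det-cong {zero}  M≗N = refl
  det-cong {suc k} M≗N = altSum-cong λ j →
    cong₂ _*_ (M≗N zero j) (det-cong λ p q → M≗N (suc p) (punchIn j q))

∀-function? : ∀ {k n} {P : (Fin k → Fin n) → Set} →
              (∀ {f g} → f ≗ g → P f → P g) → (∀ f → Dec (P f)) → Dec (∀ f → P f)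
∀-function? {zero}  resp P? = map′ (λ p f → resp (λ ()) p) (λ h → h []ᶠ) (P? []ᶠ)
∀-function? {suc k} resp P? =
  map′ (λ h f → resp (λ { zero → refl ; (suc p) → refl }) (h (f zero) (f ∘ suc)))
       (λ h x f → h (x ∷ᶠ f))
       (all? λ x → ∀-function? (λ f≗g → resp λ { zero → refl ; (suc p) → f≗g p })
                               (λ f → P? (x ∷ᶠ f)))

_⇔-dec_ : ∀ {A B : Set} → Dec A → Dec B → Dec (A ⇔ B)
a? ⇔-dec b? = map′ (λ (f , g) → mk⇔ f g) (λ e → Equivalence.to e , Equivalence.from e)
                   ((a? →-dec b?) ×-dec (b? →-dec a?))

exponentVectors : (k d : ℕ) → List (Fin k → ℕ)
exponentVectors zero    d = []ᶠ ∷ []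
exponentVectors (suc k) d =
  concatMap (λ e → map (e ∷ᶠ_) (exponentVectors k (d ∸ e))) (upTo (suc d))

module Representation (R : RawRing 0ℓ 0ℓ) (_≟_ : Decidable (RawRing._≈_ R))
                      {m} (gens : Fin m → RawRing.Carrier R) where
  private module R = RawRing R
  open Monomials R using (prodPow; posPart; negPart)

  partialField : PartialField
  partialField = record { ring = fracRing R ; Elem = Proper R ; G = GeneratedBy R gens }

  open PartialField partialField using (Carrier; _≈_; 0#; G)
  open PF partialField
    using (StrictlyIncreasing; det; sub; IsPMatrix; IsColumnMatroidOf; Representable)

  _≈?_ : Decidable _≈_
  (x , y) ≈? (z , w) = (x R.* w) ≟ (z R.* y)

  monomial : Bool × (Fin m → ℤ) → Carrier
  monomial (s , e) = sign s R.* prodPow gens posPart e , prodPow gens negPart e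
    where
    sign : Bool → R.Carrier
    sign true  = R.1#
    sign false = R.- R.1#

  monomial-generated : ∀ {z} c → z ≈ monomial c → G z
  monomial-generated (true  , e) z≈c = true  , e , z≈c
  monomial-generated (false , e) z≈c = false , e , z≈c

  monomials : ℕ → List (Bool × (Fin m → ℤ))
  monomials d = concatMap (λ e → (true , +_ ∘ e) ∷ (false , +_ ∘ e) ∷ []) (exponentVectors m d)

  Certified : ℕ → Carrier → Set
  Certified d z = z ≈ 0# ⊎ Any (λ c → z ≈ monomial c) (monomials d)

  certified? : ∀ d z → Dec (Certified d z)
  certified? d z = (z ≈? 0#) ⊎-dec any? (λ c → z ≈? monomial c) (monomials d)

  certified⇒G⊎0 : ∀ {d z} → Certified d z → G z ⊎ z ≈ 0#
  certified⇒G⊎0 (inj₁ z≈0)   = inj₂ z≈0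
  certified⇒G⊎0 (inj₂ found) with satisfied found
  ... | c , z≈c = inj₁ (monomial-generated c z≈c)

  module _ {k n : ℕ} where
    strictlyIncreasing? : (f : Fin k → Fin n) → Dec (StrictlyIncreasing f)
    strictlyIncreasing? f = all? λ p → all? λ q → (p <? q) →-dec (f p <? f q)

    strictlyIncreasing-resp : ∀ {f g : Fin k → Fin n} → f ≗ g →
                              StrictlyIncreasing f → StrictlyIncreasing g
    strictlyIncreasing-resp f≗g sf p q p<q = subst₂ _<_ (f≗g p) (f≗g q) (sf p q p<q)

    strictlyIncreasing⇒≤ : (f : Fin k → Fin n) → StrictlyIncreasing f → k ℕ.≤ n
    strictlyIncreasing⇒≤ f sf = ≮⇒≥ λ n<k →
      let p , q , p<q , fp≡fq = pigeonhole n<k f in <-irrefl fp≡fq (sf p q p<q)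

    ∀-increasing? : ∀ {Q : (Fin k → Fin n) → Set} → (∀ {f g} → f ≗ g → Q f → Q g) →
                    (∀ f → Dec (Q f)) → Dec (∀ f → StrictlyIncreasing f → Q f)
    ∀-increasing? resp Q? =
      ∀-function? (λ f≗g h sg → resp f≗g (h (strictlyIncreasing-resp (sym ∘ f≗g) sg)))
                  (λ f → strictlyIncreasing? f →-dec Q? f)

  module _ {r n : ℕ} (A : Fin r → Fin n → R.Carrier) where
    Â : Fin r → Fin n → Carrier
    Â p q = toFrac R (A p q)

    minor-cong : ∀ {k} {f f′ : Fin k → Fin r} {g g′ : Fin k → Fin n} →
                 f ≗ f′ → g ≗ g′ → det (sub Â f g) ≡ det (sub Â f′ g′)
    minor-cong f≗f′ g≗g′ = det-cong λ p q → cong₂ Â (f≗f′ p) (g≗g′ q)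

    MinorsOfSize : ℕ → ℕ → Set
    MinorsOfSize d k = ∀ (f : Fin k → Fin r) → StrictlyIncreasing f →
      ∀ (g : Fin k → Fin n) → StrictlyIncreasing g → Certified d (det (sub Â f g))

    minorsOfSize? : ∀ d k → Dec (MinorsOfSize d k)
    minorsOfSize? d k =
      ∀-increasing? (λ f≗f′ h g sg → subst (Certified d) (minor-cong f≗f′ λ _ → refl) (h g sg))
        λ f → ∀-increasing? (subst (Certified d) ∘ minor-cong λ _ → refl)
          λ g → certified? d _

    isPMatrix : ∀ d → ¬ (R.1# R.≈ R.0#) → (∀ {k} → k ℕ.< suc r → MinorsOfSize d k) →
                IsPMatrix Â
    isPMatrix d 1≉0 minors =
      (λ _ _ → 1≉0) , λ k f g sf sg → certified⇒G⊎0 (minor k f sf g sg)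
      where
      minor : ∀ k → MinorsOfSize d k
      minor k with k ≤? r
      ... | yes k≤r = minors (s≤s k≤r)
      ... | no  k≰r = λ f sf → ⊥-elim (k≰r (strictlyIncreasing⇒≤ f sf))

    module _ {Basis : (Fin r → Fin n) → Set} (Basis? : ∀ g → Dec (Basis g))
             (Basis-resp : ∀ {g g′} → g ≗ g′ → Basis g → Basis g′) where
      isColumnMatroidOf? : Dec (IsColumnMatroidOf Â Basis)
      isColumnMatroidOf? = ∀-increasing? resp λ g → ¬? (_ ≈? 0#) ⇔-dec Basis? g
        where
        resp : ∀ {g g′} → g ≗ g′ →
               (¬ det (λ p q → Â p (g q)) ≈ 0#) ⇔ Basis g →
               (¬ det (λ p q → Â p (g′ q)) ≈ 0#) ⇔ Basis g′
        resp {g′ = g′} g≗g′ e =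
          subst (λ z → (¬ z ≈ 0#) ⇔ Basis g′) (det-cong λ p q → cong (Â p) (g≗g′ q))
                (mk⇔ (Basis-resp g≗g′ ∘ to) (from ∘ Basis-resp (sym ∘ g≗g′)))
          where open Equivalence e

      representable : ∀ d → False (R.1# ≟ R.0#) →
                      True (allUpTo? (minorsOfSize? d) (suc r)) → True isColumnMatroidOf? →
                      Representable r n Basis
      representable d 1≉0 minors columns =
        Â , isPMatrix d (toWitnessFalse 1≉0) (toWitness minors) , toWitness columns

isZero? : (x : GF4) → Dec (x ≡ o)
isZero? o  = yes refl
isZero? i  = no λ ()
isZero? a  = no λ ()
isZero? a² = no λ ()

S10Basis? : ∀ g → Dec (S10Basis g)
S10Basis? g = ¬? (isZero? _)

S10Basis-resp : ∀ {g g′} → g ≗ g′ → S10Basis g → S10Basis g′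
S10Basis-resp g≗g′ basis det≡o =
  basis (trans (det-cong {R = GF4ring} λ p q → cong (B11matrix p ∘ S10label) (g≗g′ q)) det≡o)

𝕌₂-matrix : Fin 3 → Fin 10 → RawRing.Carrier ℤ[α₁,α₂]
𝕌₂-matrix p q = lookup (lookup rows p) q
  where
  open RawRing ℤ[α₁,α₂]
  open U2gens using (α₁; α₂)
  rows : Vec (Vec Carrier 10) 3
  rows = (0# ∷ᵛ 0# ∷ᵛ - 1# ∷ᵛ 0# ∷ᵛ - α₁ ∷ᵛ 1# ∷ᵛ 0# ∷ᵛ α₂ + - α₁ ∷ᵛ α₂ ∷ᵛ 1# ∷ᵛ []ᵛ)
     ∷ᵛ (0# ∷ᵛ - 1# ∷ᵛ 1# ∷ᵛ - 1# ∷ᵛ 1# ∷ᵛ 0# ∷ᵛ - α₂ ∷ᵛ 1# + - α₂ ∷ᵛ 0# ∷ᵛ 0# ∷ᵛ []ᵛ)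
     ∷ᵛ (1# ∷ᵛ 0# ∷ᵛ 0# ∷ᵛ 1# ∷ᵛ 0# ∷ᵛ - 1# ∷ᵛ α₁ ∷ᵛ α₁ + - 1# ∷ᵛ - 1# ∷ᵛ 0# ∷ᵛ []ᵛ)
     ∷ᵛ []ᵛ

-- Horner evaluation at α₂ = x − 1; the coefficients, polynomials in α₁, are
-- reread as polynomials in x.
specialise : RawRing.Carrier ℤ[α₁,α₂] → RawRing.Carrier ℤ[x]
specialise = foldr (λ c p → c + (X + - 1#) * p) 0#
  where
  open RawRing ℤ[x]
  open PolyOps ℤring using (X)

ℙ₄-matrix : Fin 3 → Fin 10 → RawRing.Carrier ℤ[x]
ℙ₄-matrix p q = specialise (𝕌₂-matrix p q)

ℤ[x]-≈-dec : Decidable (RawRing._≈_ ℤ[x])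
ℤ[x]-≈-dec = ≈ₚ-dec ℤ._≟_

ℤ[α₁,α₂]-≈-dec : Decidable (RawRing._≈_ ℤ[α₁,α₂])
ℤ[α₁,α₂]-≈-dec = ≈ₚ-dec ℤ[x]-≈-dec

module 𝕌₂-representation = Representation ℤ[α₁,α₂] ℤ[α₁,α₂]-≈-dec U2gens.gens
module ℙ₄-representation = Representation ℤ[x] ℤ[x]-≈-dec P4gens.gens

lemma14p5 : PF.Representable 𝕌₂ 3 10 S10Basis × PF.Representable ℙ₄ 3 10 S10Basis
lemma14p5 =
  𝕌₂-representation.representable 𝕌₂-matrix S10Basis? S10Basis-resp 2 _ _ _ ,
  ℙ₄-representation.representable ℙ₄-matrix S10Basis? S10Basis-resp 2 _ _ _
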